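{- Let $T$ be a tree with $n=n(T)>3$ vertices and ${\rm diam}(T)\geq\frac{2n}{3}$. Then $W(T)<E_1(T)$.
   Context: $\varepsilon_T(v)=\max_u d_T(v,u)$ is the eccentricity, ${\rm diam}(T)=\max_v\varepsilon_T(v)$, $E_1(T)=\sum_{v\in V(T)}\varepsilon_T(v)^2$, and $W(T)=\sum_{\{u,v\}\subseteq V(T)}d_T(u,v)$ is the Wiener index. -}

module Defs where

open import Data.Nat using (ℕ; zero; suc; _+_; _*_; _⊔_; _<ᵇ_)
open import Data.Bool using (Bool; true; false; _∧_; _∨_; if_then_else_; T)
open import Data.Fin using (Fin; toℕ; _≟_)
open import Data.List using (List; []; _∷_; length; map; allFin; foldr)
open import Data.Bool.ListAction using (any)
open import Data.Nat.ListAction using (sum)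
open import Data.List.Relation.Unary.Unique.Propositional using (Unique)
open import Data.List.Relation.Unary.Linked using (Linked)
open import Data.Product using (_×_; Σ)
open import Data.Empty using (⊥)
open import Relation.Nullary using (¬_)
open import Relation.Nullary.Decidable using (⌊_⌋)
open import Relation.Binary.PropositionalEquality using (_≡_)

record Graph (n : ℕ) : Set where
  field
    adj   : Fin n → Fin n → Bool
    sym   : ∀ u v → adj u v ≡ adj v u
    irrefl : ∀ u → adj u u ≡ false
open Graph public

Adj : ∀ {n} → Graph n → Fin n → Fin n → Set
Adj G u v = T (adj G u v)

data Walk {n : ℕ} (G : Graph n) : Fin n → Fin n → ℕ → Set where
  here : ∀ {u} → Walk G u u 0
  step : ∀ {u w v k} → Adj G u w → Walk G w v k → Walk G u v (suc k)

Connected : ∀ {n} → Graph n → Set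
Connected G = ∀ u v → Σ ℕ (Walk G u v)

last' : ∀ {A : Set} → A → List A → A
last' a [] = a
last' a (b ∷ bs) = last' b bs

record Cycle {n : ℕ} (G : Graph n) : Set where
  field
    v₀      : Fin n
    rest    : List (Fin n)
    long    : 2 Data.Nat.≤ length rest
    distinct : Unique (v₀ ∷ rest)
    chain   : Linked (Adj G) (v₀ ∷ rest)
    closing : Adj G (last' v₀ rest) v₀

Acyclic : ∀ {n} → Graph n → Set
Acyclic G = Cycle G → ⊥

IsTree : ∀ {n} → Graph n → Set
IsTree G = Connected G × Acyclic G

reachWithin : ∀ {n} → Graph n → ℕ → Fin n → Fin n → Bool
reachWithin G zero    u v = ⌊ u ≟ v ⌋
reachWithin G (suc k) u v =
  reachWithin G k u v ∨ any (λ w → adj G u w ∧ reachWithin G k w v) (allFin _)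

search : ∀ {n} → Graph n → Fin n → Fin n → ℕ → ℕ → ℕ
search G u v i zero = i
search G u v i (suc fuel) =
  if reachWithin G i u v then i else search G u v (suc i) fuel

-- Distance d_G(u,v): the least length of a u–v walk (= shortest path length).
-- In a connected graph on n vertices it is < n, so searching k = 0 … n suffices.
dist : ∀ {n} → Graph n → Fin n → Fin n → ℕ
dist {n} G u v = search G u v 0 n

Σv : ∀ {n} → (Fin n → ℕ) → ℕ
Σv {n} f = sum (map f (allFin n))

maxv : ∀ {n} → (Fin n → ℕ) → ℕ
maxv {n} f = foldr _⊔_ 0 (map f (allFin n))

ecc : ∀ {n} → Graph n → Fin n → ℕ
ecc G v = maxv (λ u → dist G v u)

diam : ∀ {n} → Graph n → ℕ
diam G = maxv (ecc G)

E₁ : ∀ {n} → Graph n → ℕ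
E₁ G = Σv (λ v → ecc G v * ecc G v)

W : ∀ {n} → Graph n → ℕ
W G = Σv (λ u → Σv (λ v → if toℕ u <ᵇ toℕ v then dist G u v else 0))

-- Let S(v) = Σ_u d(v,u) be the transmission of v, so that 2W ≤ Σ_v S(v); it suffices to
-- show S(v) ≤ 2ε(v)² for every v, strictly at an end x of a diametral path x … y.
-- With e = ε(v) we have S(v) = n·e − Σ_u (e − d(v,u)), and the deficit Σ_u (e − d(v,u))
-- is bounded below level by level: the geodesics from v to x and to y have a vertex on
-- every level k ≤ a = d(v,x), resp. k ≤ b = d(v,y), and these vertices are distinct
-- above level c = ⌊(a + b − d(x,y))/2⌋. Summing the arithmetic progressions and using
-- 2n ≤ 3d(x,y) gives 2S(v) + 2e ≤ ae + be + a(a+1) + b(b+1), which is at most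
-- 4e² + 2e, and at most 2e² + e when v = x.

module Submission where

open import Defs hiding (sym)
open import Data.Bool using (T; true; false; _∧_; if_then_else_)
open import Data.Bool.Properties using (T-∨; T-∧)
open import Data.Fin as Fin using (Fin; zero; suc; toℕ)
open import Data.Fin.Properties using (pigeonhole; toℕ<n)
import Data.List as List
open import Data.List.Properties using (map-tabulate)
open import Data.List.Relation.Unary.Any.Properties using (any⁺; any⁻; tabulate⁺; tabulate⁻)
open import Data.Nat
open import Data.Nat.DivMod using (_/_; m/n*n≤m; m*n/n≡m; /-monoˡ-≤)
open import Data.Nat.Induction using (<-wellFounded)
open import Data.Nat.Properties
open import Algebra.Properties.Semiring.Sum +-*-semiring
open import Data.Nat.Tactic.RingSolver using (solve-∀)
open import Data.Product using (∃-syntax; _×_; _,_; proj₂)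
open import Data.Sum using (inj₁; inj₂)
import Data.Vec.Functional as Vector
open import Function using (id; _∘_; Equivalence)
open import Induction.WellFounded using (Acc; acc)
open import Relation.Binary.PropositionalEquality
open import Relation.Nullary using (Dec; yes; no; ¬_; contradiction)
open import Relation.Nullary.Decidable using (fromWitness; toWitness)

foldr-allFin : ∀ {A B : Set} (_∙_ : A → B → B) (z : B) {n} (f : Fin n → A) →
               List.foldr _∙_ z (List.map f (List.allFin n)) ≡ Vector.foldr _∙_ z f
foldr-allFin _∙_ z {zero}  f = refl
foldr-allFin _∙_ z {suc n} f = cong (f zero ∙_) (begin
  List.foldr _∙_ z (List.map f (List.tabulate suc))
    ≡⟨ cong (List.foldr _∙_ z) (trans (map-tabulate suc f) (sym (map-tabulate id (f ∘ suc)))) ⟩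
  List.foldr _∙_ z (List.map (f ∘ suc) (List.allFin n))
    ≡⟨ foldr-allFin _∙_ z (f ∘ suc) ⟩
  Vector.foldr _∙_ z (f ∘ suc) ∎)
  where open ≡-Reasoning

Σv≡sum : ∀ {n} (f : Fin n → ℕ) → Σv f ≡ sum f
Σv≡sum = foldr-allFin _+_ 0

sum-const : ∀ n c → ∑[ i < n ] c ≡ n * c
sum-const zero    c = refl
sum-const (suc n) c = cong (c +_) (sum-const n c)

sum-mono-≤ : ∀ {n} {f g : Fin n → ℕ} → (∀ i → f i ≤ g i) → sum f ≤ sum g
sum-mono-≤ {zero}  f≤g = z≤n
sum-mono-≤ {suc n} f≤g = +-mono-≤ (f≤g zero) (sum-mono-≤ (f≤g ∘ suc))

sum-mono-< : ∀ {n} {f g : Fin n → ℕ} → (∀ i → f i ≤ g i) → ∀ i → f i < g i → sum f < sum g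
sum-mono-< f≤g zero    fi<gi = +-mono-<-≤ fi<gi (sum-mono-≤ (f≤g ∘ suc))
sum-mono-< f≤g (suc i) fi<gi = +-mono-≤-< (f≤g zero) (sum-mono-< (f≤g ∘ suc) i fi<gi)

≤-sum : ∀ {n} (f : Fin n → ℕ) i → f i ≤ sum f
≤-sum f zero    = m≤m+n (f zero) _
≤-sum f (suc i) = ≤-trans (≤-sum (f ∘ suc) i) (m≤n+m _ (f zero))

+-≤-sum : ∀ {n} (f : Fin n → ℕ) {i j} → i ≢ j → f i + f j ≤ sum f
+-≤-sum f {zero}  {zero}  i≢j = contradiction refl i≢j
+-≤-sum f {zero}  {suc j} i≢j = +-monoʳ-≤ (f zero) (≤-sum (f ∘ suc) j)
+-≤-sum f {suc i} {zero}  i≢j = subst (_≤ sum f) (+-comm (f zero) (f (suc i)))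
                                  (+-monoʳ-≤ (f zero) (≤-sum (f ∘ suc) i))
+-≤-sum f {suc i} {suc j} i≢j = ≤-trans (+-≤-sum (f ∘ suc) (i≢j ∘ cong suc)) (m≤n+m _ (f zero))

⨆ : ∀ {n} → (Fin n → ℕ) → ℕ
⨆ = Vector.foldr _⊔_ 0

≤-maxv : ∀ {n} (f : Fin n → ℕ) i → f i ≤ maxv f
≤-maxv f i = subst (f i ≤_) (sym (foldr-allFin _⊔_ 0 f)) (≤-⨆ f i)
  where
  ≤-⨆ : ∀ {n} (f : Fin n → ℕ) i → f i ≤ ⨆ f
  ≤-⨆ f zero    = m≤m⊔n (f zero) _
  ≤-⨆ f (suc i) = ≤-trans (≤-⨆ (f ∘ suc) i) (m≤n⊔m (f zero) _)

maxv-attained : ∀ {n} (f : Fin (suc n) → ℕ) → ∃[ i ] maxv f ≡ f i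
maxv-attained f = let i , eq = ⨆-attained f in i , trans (foldr-allFin _⊔_ 0 f) eq
  where
  ⨆-attained : ∀ {n} (f : Fin (suc n) → ℕ) → ∃[ i ] ⨆ f ≡ f i
  ⨆-attained {zero}  f = zero , ⊔-identityʳ (f zero)
  ⨆-attained {suc n} f with ⨆-attained (f ∘ suc) | ≤-total (f zero) (⨆ (f ∘ suc))
  ... | i , eq | inj₁ f0≤ = suc i , trans (m≤n⇒m⊔n≡n f0≤) eq
  ... | _      | inj₂ f0≥ = zero , m≥n⇒m⊔n≡m f0≥

𝟙[_] : ∀ {P : Set} → Dec P → ℕ
𝟙[ yes _ ] = 1
𝟙[ no _ ]  = 0

𝟙-yes : ∀ {P : Set} (P? : Dec P) → P → 𝟙[ P? ] ≡ 1
𝟙-yes (yes _) _ = refl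
𝟙-yes (no ¬p) p = contradiction p ¬p

𝟙-no : ∀ {P : Set} (P? : Dec P) → ¬ P → 𝟙[ P? ] ≡ 0
𝟙-no (yes p) ¬p = contradiction p ¬p
𝟙-no (no _)  _  = refl

sumBelow : ℕ → (ℕ → ℕ) → ℕ
sumBelow zero    f = 0
sumBelow (suc m) f = sumBelow m f + f m

sumBelow-cong : ∀ m {f g : ℕ → ℕ} → (∀ k → k < m → f k ≡ g k) → sumBelow m f ≡ sumBelow m g
sumBelow-cong zero    f≡g = refl
sumBelow-cong (suc m) f≡g = cong₂ _+_ (sumBelow-cong m (λ k k<m → f≡g k (m<n⇒m<1+n k<m))) (f≡g m ≤-refl)

sumBelow-mono : ∀ m {f g : ℕ → ℕ} → (∀ k → f k ≤ g k) → sumBelow m f ≤ sumBelow m g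
sumBelow-mono zero    f≤g = z≤n
sumBelow-mono (suc m) f≤g = +-mono-≤ (sumBelow-mono m f≤g) (f≤g m)

sumBelow-const : ∀ m c → sumBelow m (λ _ → c) ≡ m * c
sumBelow-const zero    c = refl
sumBelow-const (suc m) c = trans (cong (_+ c) (sumBelow-const m c)) (+-comm (m * c) c)

sumBelow-zero : ∀ m {f : ℕ → ℕ} → (∀ k → k < m → f k ≡ 0) → sumBelow m f ≡ 0
sumBelow-zero m f≡0 = trans (sumBelow-cong m f≡0) (trans (sumBelow-const m 0) (*-zeroʳ m))

sumBelow-distrib-+ : ∀ m (f g : ℕ → ℕ) → sumBelow m (λ k → f k + g k) ≡ sumBelow m f + sumBelow m g
sumBelow-distrib-+ zero    f g = refl
sumBelow-distrib-+ (suc m) f g = begin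
  sumBelow m (λ k → f k + g k) + (f m + g m)   ≡⟨ cong (_+ (f m + g m)) (sumBelow-distrib-+ m f g) ⟩
  (sumBelow m f + sumBelow m g) + (f m + g m)   ≡⟨ +-+-interchange (sumBelow m f) _ _ _ ⟩
  (sumBelow m f + f m) + (sumBelow m g + g m)   ∎
  where
  open ≡-Reasoning
  +-+-interchange : ∀ p q r s → (p + q) + (r + s) ≡ (p + r) + (q + s)
  +-+-interchange = solve-∀

sum-sumBelow-comm : ∀ {n} m (h : Fin n → ℕ → ℕ) →
                    ∑[ i < n ] sumBelow m (h i) ≡ sumBelow m (λ k → ∑[ i < n ] h i k)
sum-sumBelow-comm {n} zero    h = trans (sum-const n 0) (*-zeroʳ n)
sum-sumBelow-comm     (suc m) h =
  trans (∑-distrib-+ (λ i → sumBelow m (h i)) (λ i → h i m)) (cong (_+ ∑[ i < _ ] h i m) (sum-sumBelow-comm m h))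

sumBelow-point : ∀ {m j} (f : ℕ → ℕ) → j < m → sumBelow m (λ k → f k * 𝟙[ j ≟ k ]) ≡ f j
sumBelow-point {suc m} {j} f j<1+m with j ≟ m
... | yes refl = cong₂ _+_ (sumBelow-zero j vanishes) (*-identityʳ (f j))
  where
  vanishes : ∀ k → k < j → f k * 𝟙[ j ≟ k ] ≡ 0
  vanishes k k<j = trans (cong (f k *_) (𝟙-no (j ≟ k) (>⇒≢ k<j))) (*-zeroʳ (f k))
... | no j≢m   = trans (cong₂ _+_ (sumBelow-point f (≤∧≢⇒< (≤-pred j<1+m) j≢m)) (*-zeroʳ (f m)))
                       (+-identityʳ (f j))

sumBelow-truncate : ∀ {m j} (f : ℕ → ℕ) → j < m →
                    sumBelow m (λ k → f k * 𝟙[ k ≤? j ]) ≡ sumBelow (suc j) f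
sumBelow-truncate {suc m} {j} f j<1+m with m ≤? j
... | yes m≤j rewrite ≤-antisym (≤-pred j<1+m) m≤j = cong₂ _+_ (sumBelow-cong m retained) (*-identityʳ (f m))
  where
  retained : ∀ k → k < m → f k * 𝟙[ k ≤? m ] ≡ f k
  retained k k<m = trans (cong (f k *_) (𝟙-yes (k ≤? m) (<⇒≤ k<m))) (*-identityʳ (f k))
... | no m≰j = trans (cong₂ _+_ (sumBelow-truncate f (≰⇒> m≰j)) (*-zeroʳ (f m))) (+-identityʳ _)

sumBelow-id-double : ∀ j → 2 * sumBelow (suc j) id ≡ j * suc j
sumBelow-id-double zero    = refl
sumBelow-id-double (suc j) = begin
  2 * (sumBelow (suc j) id + suc j)       ≡⟨ *-distribˡ-+ 2 (sumBelow (suc j) id) (suc j) ⟩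
  2 * sumBelow (suc j) id + 2 * suc j     ≡⟨ cong (_+ 2 * suc j) (sumBelow-id-double j) ⟩
  j * suc j + 2 * suc j                   ≡⟨ regroup j ⟩
  suc j * suc (suc j)                     ∎
  where
  open ≡-Reasoning
  regroup : ∀ j → j * suc j + 2 * suc j ≡ suc j * suc (suc j)
  regroup = solve-∀

sumBelow-∸-double : ∀ {j e} → j ≤ e → 2 * sumBelow (suc j) (e ∸_) + j * suc j ≡ 2 * (suc j * e)
sumBelow-∸-double {j} {e} j≤e = begin
  2 * G + j * suc j                          ≡⟨ cong (2 * G +_) (sym (sumBelow-id-double j)) ⟩
  2 * G + 2 * K                              ≡⟨ sym (*-distribˡ-+ 2 G K) ⟩
  2 * (G + K)                                ≡⟨ cong (2 *_) (sym (sumBelow-distrib-+ (suc j) (e ∸_) id)) ⟩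
  2 * sumBelow (suc j) (λ k → (e ∸ k) + k)   ≡⟨ cong (2 *_) (sumBelow-cong (suc j) (λ k k<1+j → m∸n+n≡m (k≤e k<1+j))) ⟩
  2 * sumBelow (suc j) (λ _ → e)             ≡⟨ cong (2 *_) (sumBelow-const (suc j) e) ⟩
  2 * (suc j * e)                            ∎
  where
  open ≡-Reasoning
  G = sumBelow (suc j) (e ∸_)
  K = sumBelow (suc j) id
  k≤e : ∀ {k} → k < suc j → k ≤ e
  k≤e k<1+j = ≤-trans (≤-pred k<1+j) j≤e

sum-fibres : ∀ {n} m (h : Fin n → ℕ) (f : ℕ → ℕ) → (∀ i → h i ≤ m) →
             ∑[ i < n ] f (h i) ≡ sumBelow (suc m) (λ k → f k * ∑[ i < n ] 𝟙[ h i ≟ k ])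
sum-fibres {n} m h f h≤m = begin
  ∑[ i < n ] f (h i)
    ≡⟨ sum-cong-≗ (λ i → sym (sumBelow-point f (s≤s (h≤m i)))) ⟩
  ∑[ i < n ] sumBelow (suc m) (λ k → f k * 𝟙[ h i ≟ k ])
    ≡⟨ sum-sumBelow-comm (suc m) (λ i k → f k * 𝟙[ h i ≟ k ]) ⟩
  sumBelow (suc m) (λ k → ∑[ i < n ] (f k * 𝟙[ h i ≟ k ]))
    ≡⟨ sumBelow-cong (suc m) (λ k _ → sym (*-distribˡ-sum (f k) (λ i → 𝟙[ h i ≟ k ]))) ⟩
  sumBelow (suc m) (λ k → f k * ∑[ i < n ] 𝟙[ h i ≟ k ]) ∎
  where open ≡-Reasoning

module _ {n : ℕ} {G : Graph n} where

  _++ʷ_ : ∀ {u w v k l} → Walk G u w k → Walk G w v l → Walk G u v (k + l)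
  here     ++ʷ q = q
  step a p ++ʷ q = step a (p ++ʷ q)

  reverseʷ : ∀ {u v k} → Walk G u v k → Walk G v u k
  reverseʷ here                     = here
  reverseʷ (step {u} {w} {k = k} a p) =
    subst (Walk G _ u) (+-comm k 1) (reverseʷ p ++ʷ step (subst T (Graph.sym G u w) a) here)

  vertexAt : ∀ {u v k} → Walk G u v k → ℕ → Fin n
  vertexAt {u} here       _       = u
  vertexAt {u} (step a p) zero    = u
  vertexAt     (step a p) (suc i) = vertexAt p i

  takeʷ : ∀ {u v k} (p : Walk G u v k) i → i ≤ k → Walk G u (vertexAt p i) i
  takeʷ here       zero    _         = here
  takeʷ (step a p) zero    _         = here
  takeʷ (step a p) (suc i) (s≤s i≤k) = step a (takeʷ p i i≤k)

  dropʷ : ∀ {u v k} (p : Walk G u v k) i → Walk G (vertexAt p i) v (k ∸ i)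
  dropʷ here       zero    = here
  dropʷ here       (suc i) = here
  dropʷ (step a p) zero    = step a p
  dropʷ (step a p) (suc i) = dropʷ p i

  walk⇒reachWithin : ∀ {u v j} k → Walk G u v j → j ≤ k → T (reachWithin G k u v)
  walk⇒reachWithin zero    here       z≤n       = fromWitness refl
  walk⇒reachWithin (suc k) here       _         = Equivalence.from T-∨ (inj₁ (walk⇒reachWithin k here z≤n))
  walk⇒reachWithin {u} {v} (suc k) (step {w = w} a p) (s≤s j≤k) =
    Equivalence.from T-∨ (inj₂ (any⁺ (λ w → adj G u w ∧ reachWithin G k w v)
      (tabulate⁺ {f = id} w (Equivalence.from T-∧ (a , walk⇒reachWithin k p j≤k)))))

  reachWithin⇒walk : ∀ {u v} k → T (reachWithin G k u v) → ∃[ j ] j ≤ k × Walk G u v j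
  reachWithin⇒walk {u} {v} zero r with toWitness {a? = u Fin.≟ v} r
  ... | refl = 0 , z≤n , here
  reachWithin⇒walk {u} {v} (suc k) r with Equivalence.to T-∨ r
  ... | inj₁ r′ = let j , j≤k , p = reachWithin⇒walk k r′ in j , m≤n⇒m≤1+n j≤k , p
  ... | inj₂ r′ = let w , aw = tabulate⁻ {f = id} (any⁻ (λ w → adj G u w ∧ reachWithin G k w v) _ r′)
                      a , r″ = Equivalence.to T-∧ aw
                      j , j≤k , p = reachWithin⇒walk k r″
                  in suc j , s≤s j≤k , step a p

  search-≤ : ∀ {u v} i fuel j → T (reachWithin G j u v) → i ≤ j → search G u v i fuel ≤ j
  search-≤         i zero       j _ i≤j = i≤j
  search-≤ {u} {v} i (suc fuel) j r i≤j with reachWithin G i u v in eq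
  ... | true  = i≤j
  ... | false = search-≤ (suc i) fuel j r (≤∧≢⇒< i≤j λ { refl → subst T eq r })

  search-reaches : ∀ {u v} i fuel j → T (reachWithin G j u v) → i ≤ j → j ≤ i + fuel →
                   T (reachWithin G (search G u v i fuel) u v)
  search-reaches {u} {v} i zero j r i≤j j≤i+0 =
    subst (λ m → T (reachWithin G m u v)) (≤-antisym (subst (j ≤_) (+-identityʳ i) j≤i+0) i≤j) r
  search-reaches {u} {v} i (suc fuel) j r i≤j j≤i+1+fuel with reachWithin G i u v in eq
  ... | true  = subst T (sym eq) _
  ... | false = search-reaches (suc i) fuel j r (≤∧≢⇒< i≤j λ { refl → subst T eq r })
                               (subst (j ≤_) (+-suc i fuel) j≤i+1+fuel)

  dist≤length : ∀ {u v j} → Walk G u v j → dist G u v ≤ j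
  dist≤length {j = j} p = search-≤ 0 n j (walk⇒reachWithin j p ≤-refl) z≤n

  dist-refl : ∀ u → dist G u u ≡ 0
  dist-refl u = n≤0⇒n≡0 (dist≤length here)

  shortcut : ∀ {u v k} (p : Walk G u v k) {i j} → i < j → j ≤ k → vertexAt p i ≡ vertexAt p j →
             Walk G u v (i + (k ∸ j))
  shortcut p {i} {j} i<j j≤k same =
    takeʷ p i (≤-trans (<⇒≤ i<j) j≤k) ++ʷ subst (λ w → Walk G w _ _) (sym same) (dropʷ p j)

  short-walk : ∀ {u v k} → Walk G u v k → ∃[ j ] j < n × Walk G u v j
  short-walk {k = k} = shorten (<-wellFounded k)
    where
    shorten : ∀ {u v k} → Acc _<_ k → Walk G u v k → ∃[ j ] j < n × Walk G u v j
    shorten {k = k} (acc rec) p with k <? n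
    ... | yes k<n = k , k<n , p
    ... | no  k≮n with pigeonhole (s≤s (≮⇒≥ k≮n)) (λ i → vertexAt p (toℕ i))
    ... | i , j , i<j , same = shorten (rec shorter) (shortcut p i<j j≤k same)
      where
      j≤k : toℕ j ≤ k
      j≤k = ≤-pred (toℕ<n j)
      shorter : toℕ i + (k ∸ toℕ j) < k
      shorter = begin-strict
        toℕ i + (k ∸ toℕ j) <⟨ +-monoˡ-< (k ∸ toℕ j) i<j ⟩
        toℕ j + (k ∸ toℕ j) ≡⟨ m+[n∸m]≡n j≤k ⟩
        k                   ∎
        where open ≤-Reasoning

  module _ (connected : Connected G) where

    -- dist only searches the lengths 0 … n, which short-walk shows to be enough.
    geodesic : ∀ u v → Walk G u v (dist G u v)
    geodesic u v =
      let j , j<n , p = short-walk (proj₂ (connected u v))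
          reaches = search-reaches 0 n j (walk⇒reachWithin j p ≤-refl) z≤n (<⇒≤ j<n)
          j′ , j′≤dist , q = reachWithin⇒walk (dist G u v) reaches
      in subst (Walk G u v) (≤-antisym j′≤dist (dist≤length q)) q

    dist-triangle : ∀ u w v → dist G u v ≤ dist G u w + dist G w v
    dist-triangle u w v = dist≤length (geodesic u w ++ʷ geodesic w v)

    dist-sym : ∀ u v → dist G u v ≡ dist G v u
    dist-sym u v = ≤-antisym (dist≤length (reverseʷ (geodesic v u))) (dist≤length (reverseʷ (geodesic u v)))

    dist-from-geodesic : ∀ u v k → dist G (vertexAt (geodesic u v) k) v ≤ dist G u v ∸ k
    dist-from-geodesic u v k = dist≤length (dropʷ (geodesic u v) k)

    dist-to-geodesic : ∀ u v k → k ≤ dist G u v → dist G u (vertexAt (geodesic u v) k) ≡ k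
    dist-to-geodesic u v k k≤d = ≤-antisym (dist≤length (takeʷ (geodesic u v) k k≤d)) k≤dist
      where
      w = vertexAt (geodesic u v) k
      k≤dist : k ≤ dist G u w
      k≤dist = +-cancelʳ-≤ (dist G u v ∸ k) k (dist G u w) (begin
        k + (dist G u v ∸ k)           ≡⟨ m+[n∸m]≡n k≤d ⟩
        dist G u v                     ≤⟨ dist-triangle u w v ⟩
        dist G u w + dist G w v        ≤⟨ +-monoʳ-≤ (dist G u w) (dist-from-geodesic u v k) ⟩
        dist G u w + (dist G u v ∸ k)  ∎)
        where open ≤-Reasoning

dist≤ecc : ∀ {n} (G : Graph n) v u → dist G v u ≤ ecc G v
dist≤ecc G v = ≤-maxv (dist G v)

diametral-pair : ∀ {n} (G : Graph (suc n)) → ∃[ x ] ∃[ y ] diam G ≡ dist G x y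
diametral-pair G =
  let x , diam≡ecc = maxv-attained (ecc G)
      y , ecc≡dist = maxv-attained (dist G x)
  in x , y , trans diam≡ecc ecc≡dist

transmission : ∀ {n} → Graph n → Fin n → ℕ
transmission {n} G v = ∑[ u < n ] dist G v u

2*W≤sum-transmission : ∀ {n} {G : Graph n} → Connected G → 2 * W G ≤ ∑[ v < n ] transmission G v
2*W≤sum-transmission {n} {G} connected = begin
  2 * W G
    ≡⟨ cong (2 *_) W≡ ⟩
  2 * W′
    ≡⟨ cong (W′ +_) (+-identityʳ W′) ⟩
  W′ + W′
    ≡⟨ cong (W′ +_) (∑-comm (λ v u → w v u)) ⟩
  W′ + ∑[ u < n ] ∑[ v < n ] w v u
    ≡⟨ ∑-distrib-+ (λ u → ∑[ v < n ] w u v) (λ u → ∑[ v < n ] w v u) ⟨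
  ∑[ u < n ] (∑[ v < n ] w u v + ∑[ v < n ] w v u)
    ≡⟨ sum-cong-≗ (λ u → sym (∑-distrib-+ (w u) (λ v → w v u))) ⟩
  ∑[ u < n ] ∑[ v < n ] (w u v + w v u)
    ≤⟨ sum-mono-≤ (λ u → sum-mono-≤ (both-orders u)) ⟩
  ∑[ u < n ] transmission G u ∎
  where
  open ≤-Reasoning
  w : Fin n → Fin n → ℕ
  w u v = if toℕ u <ᵇ toℕ v then dist G u v else 0
  W′ = ∑[ u < n ] ∑[ v < n ] w u v
  W≡ : W G ≡ W′
  W≡ = trans (Σv≡sum (λ u → Σv (w u))) (sum-cong-≗ (λ u → Σv≡sum (w u)))
  both-orders : ∀ u v → w u v + w v u ≤ dist G u v
  both-orders u v with toℕ u <ᵇ toℕ v in u<v | toℕ v <ᵇ toℕ u in v<u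
  ... | true  | true  = contradiction (<ᵇ⇒< (toℕ v) (toℕ u) (subst T (sym v<u) _))
                                      (<-asym (<ᵇ⇒< (toℕ u) (toℕ v) (subst T (sym u<v) _)))
  ... | true  | false = ≤-reflexive (+-identityʳ _)
  ... | false | true  = ≤-reflexive (dist-sym connected v u)
  ... | false | false = z≤n

sphere : ∀ {n} → Graph n → Fin n → ℕ → ℕ
sphere {n} G v k = ∑[ u < n ] 𝟙[ dist G v u ≟ k ]

transmission-arithmetic : ∀ {n d e a b c S} → 2 * n ≤ 3 * d → d + 2 * c ≤ a + b →
  2 * S + (2 * (suc a * e) + 2 * (suc b * e) + c * suc c) ≤ 2 * (n * e) + 2 * (suc c * e) + (a * suc a + b * suc b) →
  2 * S + 2 * e ≤ a * e + b * e + a * suc a + b * suc b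
transmission-arithmetic {n} {d} {e} {a} {b} {c} {S} 2n≤3d d+2c≤a+b doubled =
  m+n≤o⇒m≤o (2 * S + 2 * e) (+-cancelʳ-≤ K _ _ (begin
    2 * S + 2 * e + (c * suc c + 4 * (c * e)) + K
      ≡⟨ regroup₁ S e a b c ⟩
    2 * S + (2 * (suc a * e) + 2 * (suc b * e) + c * suc c) + 6 * (c * e)
      ≤⟨ +-monoˡ-≤ (6 * (c * e)) doubled ⟩
    2 * (n * e) + 2 * (suc c * e) + (a * suc a + b * suc b) + 6 * (c * e)
      ≡⟨ regroup₂ n e a b c ⟩
    (2 * n + 3 * (2 * c)) * e + R
      ≤⟨ +-monoˡ-≤ R (*-monoˡ-≤ e (+-monoˡ-≤ (3 * (2 * c)) 2n≤3d)) ⟩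
    (3 * d + 3 * (2 * c)) * e + R
      ≡⟨ cong (λ m → m * e + R) (sym (*-distribˡ-+ 3 d (2 * c))) ⟩
    3 * (d + 2 * c) * e + R
      ≤⟨ +-monoˡ-≤ R (*-monoˡ-≤ e (*-monoʳ-≤ 3 d+2c≤a+b)) ⟩
    3 * (a + b) * e + R
      ≡⟨ regroup₃ e a b c ⟩
    a * e + b * e + a * suc a + b * suc b + K ∎))
  where
  open ≤-Reasoning
  R = 2 * (suc c * e) + (a * suc a + b * suc b)
  K = 2 * (a * e) + 2 * (b * e) + 2 * e + 2 * (c * e)
  regroup₁ : ∀ S e a b c → 2 * S + 2 * e + (c * suc c + 4 * (c * e)) + (2 * (a * e) + 2 * (b * e) + 2 * e + 2 * (c * e))
             ≡ 2 * S + (2 * (suc a * e) + 2 * (suc b * e) + c * suc c) + 6 * (c * e)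
  regroup₁ = solve-∀
  regroup₂ : ∀ n e a b c → 2 * (n * e) + 2 * (suc c * e) + (a * suc a + b * suc b) + 6 * (c * e)
             ≡ (2 * n + 3 * (2 * c)) * e + (2 * (suc c * e) + (a * suc a + b * suc b))
  regroup₂ = solve-∀
  regroup₃ : ∀ e a b c → 3 * (a + b) * e + (2 * (suc c * e) + (a * suc a + b * suc b))
             ≡ a * e + b * e + a * suc a + b * suc b + (2 * (a * e) + 2 * (b * e) + 2 * e + 2 * (c * e))
  regroup₃ = solve-∀

transmission-bound⇒≤ : ∀ {e a b S} → a ≤ e → b ≤ e →
  2 * S + 2 * e ≤ a * e + b * e + a * suc a + b * suc b → S ≤ 2 * (e * e)
transmission-bound⇒≤ {e} {a} {b} {S} a≤e b≤e bound =
  *-cancelˡ-≤ 2 (+-cancelʳ-≤ (2 * e) (2 * S) (2 * (2 * (e * e))) (begin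
    2 * S + 2 * e                                   ≤⟨ bound ⟩
    a * e + b * e + a * suc a + b * suc b           ≤⟨ +-mono-≤ (+-mono-≤ (+-mono-≤ (*-monoˡ-≤ e a≤e) (*-monoˡ-≤ e b≤e))
                                                                   (*-mono-≤ a≤e (s≤s a≤e)))
                                                         (*-mono-≤ b≤e (s≤s b≤e)) ⟩
    e * e + e * e + e * suc e + e * suc e           ≡⟨ regroup e ⟩
    2 * (2 * (e * e)) + 2 * e                       ∎))
  where
  open ≤-Reasoning
  regroup : ∀ e → e * e + e * e + e * suc e + e * suc e ≡ 2 * (2 * (e * e)) + 2 * e
  regroup = solve-∀

transmission-bound⇒< : ∀ {e a b S} → a ≡ 0 → b ≤ e → 0 < e →
  2 * S + 2 * e ≤ a * e + b * e + a * suc a + b * suc b → S < 2 * (e * e)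
transmission-bound⇒< {e} {_} {b} {S} refl b≤e 0<e bound =
  ≤-trans (s≤s (m≤m+n S (S + 0))) (+-cancelʳ-≤ e (suc (2 * S)) (2 * (e * e)) (begin
    suc (2 * S) + e          ≡⟨ +-suc (2 * S) e ⟨
    2 * S + suc e            ≤⟨ +-monoʳ-≤ (2 * S) (+-monoˡ-≤ e 0<e) ⟩
    2 * S + (e + e)          ≡⟨ cong (λ m → 2 * S + (e + m)) (sym (+-identityʳ e)) ⟩
    2 * S + 2 * e            ≤⟨ bound ⟩
    b * e + 0 + b * suc b    ≤⟨ +-mono-≤ (+-monoˡ-≤ 0 (*-monoˡ-≤ e b≤e)) (*-mono-≤ b≤e (s≤s b≤e)) ⟩
    e * e + 0 + e * suc e    ≡⟨ regroup e ⟩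
    2 * (e * e) + e          ∎))
  where
  open ≤-Reasoning
  regroup : ∀ e → e * e + 0 + e * suc e ≡ 2 * (e * e) + e
  regroup = solve-∀

module TransmissionBound {n : ℕ} {G : Graph n} (connected : Connected G) (x y v : Fin n) where

  e a b d c : ℕ
  e = ecc G v
  a = dist G v x
  b = dist G v y
  d = dist G x y
  c = (a + b ∸ d) / 2

  a≤e : a ≤ e
  a≤e = dist≤ecc G v x

  b≤e : b ≤ e
  b≤e = dist≤ecc G v y

  d≤a+b : d ≤ a + b
  d≤a+b = subst (λ m → d ≤ m + b) (dist-sym connected x v) (dist-triangle connected x v y)

  d+2c≤a+b : d + 2 * c ≤ a + b
  d+2c≤a+b = begin
    d + 2 * c           ≡⟨ cong (d +_) (*-comm 2 c) ⟩
    d + c * 2           ≤⟨ +-monoʳ-≤ d (m/n*n≤m (a + b ∸ d) 2) ⟩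
    d + (a + b ∸ d)     ≡⟨ m+[n∸m]≡n d≤a+b ⟩
    a + b               ∎
    where open ≤-Reasoning

  ≤c : ∀ {k} → 2 * k + d ≤ a + b → k ≤ c
  ≤c {k} 2k+d≤a+b = begin
    k                    ≡⟨ m*n/n≡m k 2 ⟨
    k * 2 / 2            ≤⟨ /-monoˡ-≤ 2 (subst (_≤ a + b ∸ d) (*-comm 2 k) (m+n≤o⇒m≤o∸n (2 * k) 2k+d≤a+b)) ⟩
    (a + b ∸ d) / 2      ∎
    where open ≤-Reasoning

  c≤e : c ≤ e
  c≤e = *-cancelˡ-≤ 2 (begin
    2 * c           ≤⟨ m≤n+m (2 * c) d ⟩
    d + 2 * c       ≤⟨ d+2c≤a+b ⟩
    a + b           ≤⟨ +-mono-≤ a≤e b≤e ⟩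
    e + e           ≡⟨ cong (e +_) (+-identityʳ e) ⟨
    2 * e           ∎)
    where open ≤-Reasoning

  X Y : ℕ → Fin n
  X = vertexAt (geodesic connected v x)
  Y = vertexAt (geodesic connected v y)

  -- If the geodesics to x and y met at a level above c, the walk x → X k → y would be too short.
  X≢Y : ∀ {k} → k ≤ a → k ≤ b → c < k → X k ≢ Y k
  X≢Y {k} k≤a k≤b c<k X≡Y = <⇒≱ c<k (≤c (begin
    2 * k + d                         ≤⟨ +-monoʳ-≤ (2 * k) d≤ ⟩
    2 * k + ((a ∸ k) + (b ∸ k))       ≡⟨ regroup k (a ∸ k) (b ∸ k) ⟩
    (k + (a ∸ k)) + (k + (b ∸ k))     ≡⟨ cong₂ _+_ (m+[n∸m]≡n k≤a) (m+[n∸m]≡n k≤b) ⟩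
    a + b                             ∎))
    where
    open ≤-Reasoning
    regroup : ∀ k p q → 2 * k + (p + q) ≡ (k + p) + (k + q)
    regroup = solve-∀
    d≤ : d ≤ (a ∸ k) + (b ∸ k)
    d≤ = begin
      dist G x y                      ≤⟨ dist-triangle connected x (X k) y ⟩
      dist G x (X k) + dist G (X k) y ≡⟨ cong₂ _+_ (dist-sym connected x (X k)) (cong (λ w → dist G w y) X≡Y) ⟩
      dist G (X k) x + dist G (Y k) y ≤⟨ +-mono-≤ (dist-from-geodesic connected v x k)
                                                  (dist-from-geodesic connected v y k) ⟩
      (a ∸ k) + (b ∸ k)               ∎

  on-sphere : ∀ {u k} → dist G v u ≡ k → 𝟙[ dist G v u ≟ k ] ≡ 1
  on-sphere {u} {k} du≡k = 𝟙-yes (dist G v u ≟ k) du≡k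

  sphere-≥1 : ∀ {u k} → dist G v u ≡ k → 1 ≤ sphere G v k
  sphere-≥1 {u} du≡k = subst (_≤ sphere G v _) (on-sphere du≡k) (≤-sum _ u)

  -- X k and Y k lie on the sphere of radius k; the term 𝟙[ k ≤? c ] pays for their possible coincidence.
  sphere-bound : ∀ k → 𝟙[ k ≤? a ] + 𝟙[ k ≤? b ] ≤ sphere G v k + 𝟙[ k ≤? c ]
  sphere-bound k with k ≤? a | k ≤? b | k ≤? c
  ... | yes k≤a | yes k≤b | yes _   = +-monoˡ-≤ 1 (sphere-≥1 (dist-to-geodesic connected v x k k≤a))
  ... | yes k≤a | yes k≤b | no  k≰c =
    subst₂ (λ p q → p + q ≤ sphere G v k + 0)
      (on-sphere (dist-to-geodesic connected v x k k≤a)) (on-sphere (dist-to-geodesic connected v y k k≤b))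
      (≤-trans (+-≤-sum _ (X≢Y k≤a k≤b (≰⇒> k≰c))) (m≤m+n _ 0))
  ... | yes k≤a | no  _   | _       = ≤-trans (sphere-≥1 (dist-to-geodesic connected v x k k≤a)) (m≤m+n _ _)
  ... | no  _   | yes k≤b | _       = ≤-trans (sphere-≥1 (dist-to-geodesic connected v y k k≤b)) (m≤m+n _ _)
  ... | no  _   | no  _   | _       = z≤n

  deficit : ℕ → ℕ
  deficit j = sumBelow (suc j) (e ∸_)

  deficit-bound : deficit a + deficit b ≤ ∑[ u < n ] (e ∸ dist G v u) + deficit c
  deficit-bound = begin
    deficit a + deficit b
      ≡⟨ cong₂ _+_ (sumBelow-truncate (e ∸_) (s≤s a≤e)) (sumBelow-truncate (e ∸_) (s≤s b≤e)) ⟨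
    sumBelow (suc e) (λ k → (e ∸ k) * 𝟙[ k ≤? a ]) + sumBelow (suc e) (λ k → (e ∸ k) * 𝟙[ k ≤? b ])
      ≡⟨ sumBelow-distrib-+ (suc e) _ _ ⟨
    sumBelow (suc e) (λ k → (e ∸ k) * 𝟙[ k ≤? a ] + (e ∸ k) * 𝟙[ k ≤? b ])
      ≡⟨ sumBelow-cong (suc e) (λ k _ → *-distribˡ-+ (e ∸ k) 𝟙[ k ≤? a ] 𝟙[ k ≤? b ]) ⟨
    sumBelow (suc e) (λ k → (e ∸ k) * (𝟙[ k ≤? a ] + 𝟙[ k ≤? b ]))
      ≤⟨ sumBelow-mono (suc e) (λ k → *-monoʳ-≤ (e ∸ k) (sphere-bound k)) ⟩
    sumBelow (suc e) (λ k → (e ∸ k) * (sphere G v k + 𝟙[ k ≤? c ]))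
      ≡⟨ sumBelow-cong (suc e) (λ k _ → *-distribˡ-+ (e ∸ k) (sphere G v k) 𝟙[ k ≤? c ]) ⟩
    sumBelow (suc e) (λ k → (e ∸ k) * sphere G v k + (e ∸ k) * 𝟙[ k ≤? c ])
      ≡⟨ sumBelow-distrib-+ (suc e) _ _ ⟩
    sumBelow (suc e) (λ k → (e ∸ k) * sphere G v k) + sumBelow (suc e) (λ k → (e ∸ k) * 𝟙[ k ≤? c ])
      ≡⟨ cong₂ _+_ (sym (sum-fibres e (dist G v) (e ∸_) (dist≤ecc G v)))
                   (sumBelow-truncate (e ∸_) (s≤s c≤e)) ⟩
    ∑[ u < n ] (e ∸ dist G v u) + deficit c ∎
    where open ≤-Reasoning

  transmission+deficit : transmission G v + ∑[ u < n ] (e ∸ dist G v u) ≡ n * e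
  transmission+deficit = begin
    transmission G v + ∑[ u < n ] (e ∸ dist G v u)   ≡⟨ ∑-distrib-+ (dist G v) (λ u → e ∸ dist G v u) ⟨
    ∑[ u < n ] (dist G v u + (e ∸ dist G v u))      ≡⟨ sum-cong-≗ (λ u → m+[n∸m]≡n (dist≤ecc G v u)) ⟩
    ∑[ u < n ] e                                    ≡⟨ sum-const n e ⟩
    n * e                                           ∎
    where open ≡-Reasoning

  transmission-bound : 2 * n ≤ 3 * d → 2 * transmission G v + 2 * e ≤ a * e + b * e + a * suc a + b * suc b
  transmission-bound 2n≤3d = transmission-arithmetic {n} {d} {e} {a} {b} {c} {S} 2n≤3d d+2c≤a+b (begin
    2 * S + (2 * (suc a * e) + 2 * (suc b * e) + c * suc c)
      ≡⟨ cong₂ (λ p q → 2 * S + (p + q + c * suc c)) (sumBelow-∸-double a≤e) (sumBelow-∸-double b≤e) ⟨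
    2 * S + ((2 * deficit a + a * suc a) + (2 * deficit b + b * suc b) + c * suc c)
      ≡⟨ regroup₁ S (deficit a) (deficit b) a b c ⟩
    2 * (S + (deficit a + deficit b)) + (a * suc a + b * suc b + c * suc c)
      ≤⟨ +-monoˡ-≤ _ (*-monoʳ-≤ 2 counting) ⟩
    2 * (n * e + deficit c) + (a * suc a + b * suc b + c * suc c)
      ≡⟨ regroup₂ (n * e) (deficit c) a b c ⟩
    2 * (n * e) + (2 * deficit c + c * suc c) + (a * suc a + b * suc b)
      ≡⟨ cong (λ p → 2 * (n * e) + p + (a * suc a + b * suc b)) (sumBelow-∸-double c≤e) ⟩
    2 * (n * e) + 2 * (suc c * e) + (a * suc a + b * suc b) ∎)
    where
    open ≤-Reasoning
    S = transmission G v
    counting : S + (deficit a + deficit b) ≤ n * e + deficit c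
    counting = begin
      S + (deficit a + deficit b)                          ≤⟨ +-monoʳ-≤ S deficit-bound ⟩
      S + (∑[ u < n ] (e ∸ dist G v u) + deficit c)        ≡⟨ +-assoc S _ (deficit c) ⟨
      S + ∑[ u < n ] (e ∸ dist G v u) + deficit c          ≡⟨ cong (_+ deficit c) transmission+deficit ⟩
      n * e + deficit c                                    ∎
    regroup₁ : ∀ S p q a b c → 2 * S + ((2 * p + a * suc a) + (2 * q + b * suc b) + c * suc c)
               ≡ 2 * (S + (p + q)) + (a * suc a + b * suc b + c * suc c)
    regroup₁ = solve-∀
    regroup₂ : ∀ m r a b c → 2 * (m + r) + (a * suc a + b * suc b + c * suc c)
               ≡ 2 * m + (2 * r + c * suc c) + (a * suc a + b * suc b)
    regroup₂ = solve-∀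

module _ {n : ℕ} {G : Graph n} (connected : Connected G) {x y : Fin n} (2n≤3d : 2 * n ≤ 3 * dist G x y) where

  transmission≤2*ecc² : ∀ v → transmission G v ≤ 2 * (ecc G v * ecc G v)
  transmission≤2*ecc² v = transmission-bound⇒≤ a≤e b≤e (transmission-bound 2n≤3d)
    where open TransmissionBound connected x y v

  transmission<2*ecc² : 0 < ecc G x → transmission G x < 2 * (ecc G x * ecc G x)
  transmission<2*ecc² 0<e = transmission-bound⇒< (dist-refl x) b≤e 0<e (transmission-bound 2n≤3d)
    where open TransmissionBound connected x y x

theorem3p2 : (n : ℕ) (T : Graph n) → IsTree T → 3 < n →
    2 * n ≤ 3 * diam T → W T < E₁ T
theorem3p2 (suc n) T (connected , _) _ 2n≤3diam with diametral-pair T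
... | x , y , diam≡d = *-cancelˡ-< 2 (W T) (E₁ T) (begin-strict
  2 * W T                                   ≤⟨ 2*W≤sum-transmission connected ⟩
  ∑[ v < suc n ] transmission T v           <⟨ sum-mono-< (transmission≤2*ecc² connected {x} {y} 2n≤3d) x
                                                          (transmission<2*ecc² connected {x} {y} 2n≤3d 0<ecc) ⟩
  ∑[ v < suc n ] (2 * (ecc T v * ecc T v))  ≡⟨ *-distribˡ-sum 2 (λ v → ecc T v * ecc T v) ⟨
  2 * ∑[ v < suc n ] (ecc T v * ecc T v)    ≡⟨ cong (2 *_) (Σv≡sum (λ v → ecc T v * ecc T v)) ⟨
  2 * E₁ T                                  ∎)
  where
  open ≤-Reasoning
  2n≤3d : 2 * suc n ≤ 3 * dist T x y
  2n≤3d = subst (λ m → 2 * suc n ≤ 3 * m) diam≡d 2n≤3diam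
  0<ecc : 0 < ecc T x
  0<ecc = ≤-trans (*-cancelˡ-< 3 0 (dist T x y) (≤-trans (s≤s z≤n) 2n≤3d)) (dist≤ecc T x y)
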